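{- Let $G$ be a finite simple graph that is $(P_4 \cup P_2)$-free, and let $\omega = \omega(G)$ be its clique number. Then $\chi(G) \leq \frac{\omega(\omega+1)(\omega+2)}{6}$.
   Context: A graph $G$ is $H$-free if $G$ contains no induced subgraph isomorphic to $H$. $P_n$ denotes the path on $n$ vertices, and $P_4 \cup P_2$ denotes the disjoint union of a path on 4 vertices and a path on 2 vertices (with no edges between them). $\chi(G)$ is the chromatic number and $\omega(G)$ the clique number of $G$. -}

module Defs where

open import Data.Nat using (ℕ; suc; _+_; _*_; _≤_)
open import Data.Nat.DivMod using (_/_)
open import Data.Fin using (Fin; zero; suc)
open import Data.Bool using (Bool; true; false)
open import Data.Product using (Σ; _×_; ∃-syntax)
open import Data.Fin.Subset using (Subset; _∈_; ∣_∣)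
open import Function.Definitions using (Injective)
open import Relation.Binary.PropositionalEquality using (_≡_; _≢_)

record Graph (n : ℕ) : Set where
  field
    adj   : Fin n → Fin n → Bool
    sym   : ∀ u v → adj u v ≡ adj v u
    irrefl : ∀ v → adj v v ≡ false
open Graph public

InducedCopy : ∀ {m n} → Graph m → Graph n → Set
InducedCopy {m} {n} H G =
  Σ (Fin m → Fin n) λ f →
    Injective _≡_ _≡_ f × (∀ u v → adj G (f u) (f v) ≡ adj H u v)

HFree : ∀ {m n} → Graph m → Graph n → Set
HFree H G = InducedCopy H G → ⊥'
  where open import Data.Empty renaming (⊥ to ⊥')

-- P4 ∪ P2 on vertices 0-1-2-3 (path) and 4-5 (edge).
p4p2adj : Fin 6 → Fin 6 → Bool
p4p2adj zero (suc zero) = true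
p4p2adj (suc zero) zero = true
p4p2adj (suc zero) (suc (suc zero)) = true
p4p2adj (suc (suc zero)) (suc zero) = true
p4p2adj (suc (suc zero)) (suc (suc (suc zero))) = true
p4p2adj (suc (suc (suc zero))) (suc (suc zero)) = true
p4p2adj (suc (suc (suc (suc zero)))) (suc (suc (suc (suc (suc zero))))) = true
p4p2adj (suc (suc (suc (suc (suc zero))))) (suc (suc (suc (suc zero)))) = true
p4p2adj _ _ = false

P4∪P2 : Graph 6
P4∪P2 = record { adj = p4p2adj ; sym = s ; irrefl = i }
  where
  open import Data.Fin using (_≟_)
  open import Data.Vec using (allFin)
  s : ∀ u v → p4p2adj u v ≡ p4p2adj v u
  s zero zero = _≡_.refl
  s zero (suc zero) = _≡_.refl
  s zero (suc (suc zero)) = _≡_.refl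
  s zero (suc (suc (suc zero))) = _≡_.refl
  s zero (suc (suc (suc (suc zero)))) = _≡_.refl
  s zero (suc (suc (suc (suc (suc zero))))) = _≡_.refl
  s (suc zero) zero = _≡_.refl
  s (suc zero) (suc zero) = _≡_.refl
  s (suc zero) (suc (suc zero)) = _≡_.refl
  s (suc zero) (suc (suc (suc zero))) = _≡_.refl
  s (suc zero) (suc (suc (suc (suc zero)))) = _≡_.refl
  s (suc zero) (suc (suc (suc (suc (suc zero))))) = _≡_.refl
  s (suc (suc zero)) zero = _≡_.refl
  s (suc (suc zero)) (suc zero) = _≡_.refl
  s (suc (suc zero)) (suc (suc zero)) = _≡_.refl
  s (suc (suc zero)) (suc (suc (suc zero))) = _≡_.refl
  s (suc (suc zero)) (suc (suc (suc (suc zero)))) = _≡_.refl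
  s (suc (suc zero)) (suc (suc (suc (suc (suc zero))))) = _≡_.refl
  s (suc (suc (suc zero))) zero = _≡_.refl
  s (suc (suc (suc zero))) (suc zero) = _≡_.refl
  s (suc (suc (suc zero))) (suc (suc zero)) = _≡_.refl
  s (suc (suc (suc zero))) (suc (suc (suc zero))) = _≡_.refl
  s (suc (suc (suc zero))) (suc (suc (suc (suc zero)))) = _≡_.refl
  s (suc (suc (suc zero))) (suc (suc (suc (suc (suc zero))))) = _≡_.refl
  s (suc (suc (suc (suc zero)))) zero = _≡_.refl
  s (suc (suc (suc (suc zero)))) (suc zero) = _≡_.refl
  s (suc (suc (suc (suc zero)))) (suc (suc zero)) = _≡_.refl
  s (suc (suc (suc (suc zero)))) (suc (suc (suc zero))) = _≡_.refl
  s (suc (suc (suc (suc zero)))) (suc (suc (suc (suc zero)))) = _≡_.refl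
  s (suc (suc (suc (suc zero)))) (suc (suc (suc (suc (suc zero))))) = _≡_.refl
  s (suc (suc (suc (suc (suc zero))))) zero = _≡_.refl
  s (suc (suc (suc (suc (suc zero))))) (suc zero) = _≡_.refl
  s (suc (suc (suc (suc (suc zero))))) (suc (suc zero)) = _≡_.refl
  s (suc (suc (suc (suc (suc zero))))) (suc (suc (suc zero))) = _≡_.refl
  s (suc (suc (suc (suc (suc zero))))) (suc (suc (suc (suc zero)))) = _≡_.refl
  s (suc (suc (suc (suc (suc zero))))) (suc (suc (suc (suc (suc zero))))) = _≡_.refl
  i : ∀ v → p4p2adj v v ≡ false
  i zero = _≡_.refl
  i (suc zero) = _≡_.refl
  i (suc (suc zero)) = _≡_.refl
  i (suc (suc (suc zero))) = _≡_.refl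
  i (suc (suc (suc (suc zero)))) = _≡_.refl
  i (suc (suc (suc (suc (suc zero))))) = _≡_.refl

IsClique : ∀ {n} → Graph n → Subset n → Set
IsClique G S = ∀ u v → u ∈ S → v ∈ S → u ≢ v → adj G u v ≡ true

CliqueNumber : ∀ {n} → Graph n → ℕ → Set
CliqueNumber G w =
  (∃[ S ] (IsClique G S × ∣ S ∣ ≡ w)) × (∀ S → IsClique G S → ∣ S ∣ ≤ w)

ProperColouring : ∀ {n} → Graph n → (k : ℕ) → (Fin n → Fin k) → Set
ProperColouring G k c = ∀ u v → adj G u v ≡ true → c u ≢ c v

ChromaticAtMost : ∀ {n} → Graph n → ℕ → Set
ChromaticAtMost G k = ∃[ c ] ProperColouring G k c

-- If a vertex set is P₄-free then χ = ω on it: a maximal independent set I meets every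
-- maximum clique (otherwise a vertex of I seeing the most of the clique yields a P₄), so
-- deleting I lowers ω by one. In a (P₄ ∪ P₂)-free graph the vertices non-adjacent to both
-- ends of an edge induce a P₄-free graph.
--
-- Let K be a clique of size ω and v ∈ K; the neighbours of v have clique number ω − 1 and
-- are coloured by induction. List K ∖ {v} as u₁, …, u_{ω−1}. The non-neighbours of v that
-- are adjacent to u₁, …, u_l but not to u_{l+1} miss the edge u_{l+1} v and have clique
-- number ≤ ω − l, so they take ω − l colours; those adjacent to all of K ∖ {v} are
-- independent. Hence the non-neighbours of v take 1 + 2 + ⋯ + ω colours, and
-- χ ≤ Σ_{k ≤ ω} k(k+1)/2 = ω(ω+1)(ω+2)/6.

module Submission where

open import Defs renaming (sym to adj-sym; irrefl to adj-irrefl)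
open import Level using (0ℓ)
open import Data.Nat using (ℕ; zero; suc; _+_; _*_; _≤_; _<_; _<?_; z<s; s<s)
open import Data.Nat.Properties
open import Data.Nat.DivMod using (_/_; m*n/n≡m)
open import Data.Nat.Solver using (module +-*-Solver)
open import Data.Bool using (true; false)
open import Data.Bool.Properties using () renaming (_≟_ to _≟ᵇ_)
open import Data.Fin using (Fin; toℕ; fromℕ<) renaming (_≟_ to _≟ᶠ_)
open import Data.Fin.Patterns
open import Data.Fin.Properties using (any?; all?; toℕ-fromℕ<)
open import Data.Fin.Subset
  using (Subset; _∈_; _∉_; _⊆_; _⊈_; _∩_; _∪_; ∁; ⁅_⁆; ∣_∣; Nonempty; inside; outside; ⊥; ⊤)
open import Data.Fin.Subset.Properties
open import Data.Vec using (_∷_; []; here; there; tabulate)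
open import Data.Vec.Properties using ([]=⇒lookup; lookup⇒[]=; lookup∘tabulate)
open import Data.Product using (∃; _×_; _,_; proj₂)
open import Data.Sum using (inj₁; inj₂)
open import Data.Empty using (⊥-elim)
open import Function using (_∘_)
open import Relation.Unary using (Pred; Decidable)
open import Relation.Nullary using (Dec; yes; no; ¬_; ¬?; contradiction)
open import Relation.Nullary.Decidable using (_×-dec_; _→-dec_; decidable-stable; toWitness)
open import Relation.Binary.PropositionalEquality

∣p∪q∣≡∣p∣+∣q∣ : ∀ {n} (p q : Subset n) → (∀ {x} → x ∈ p → x ∉ q) → ∣ p ∪ q ∣ ≡ ∣ p ∣ + ∣ q ∣
∣p∪q∣≡∣p∣+∣q∣ [] [] _ = refl
∣p∪q∣≡∣p∣+∣q∣ (inside ∷ p) (inside ∷ q) disjoint = contradiction here (disjoint here)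
∣p∪q∣≡∣p∣+∣q∣ (inside ∷ p) (outside ∷ q) disjoint =
  cong suc (∣p∪q∣≡∣p∣+∣q∣ p q (λ x∈p x∈q → disjoint (there x∈p) (there x∈q)))
∣p∪q∣≡∣p∣+∣q∣ (outside ∷ p) (inside ∷ q) disjoint =
  trans (cong suc (∣p∪q∣≡∣p∣+∣q∣ p q (λ x∈p x∈q → disjoint (there x∈p) (there x∈q))))
        (sym (+-suc ∣ p ∣ ∣ q ∣))
∣p∪q∣≡∣p∣+∣q∣ (outside ∷ p) (outside ∷ q) disjoint =
  ∣p∪q∣≡∣p∣+∣q∣ p q (λ x∈p x∈q → disjoint (there x∈p) (there x∈q))

⊈⇒∃∈∉ : ∀ {n} {p q : Subset n} → p ⊈ q → ∃ λ x → x ∈ p × x ∉ q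
⊈⇒∃∈∉ {p = p} {q} p⊈q with any? (λ x → x ∈? p ×-dec ¬? (x ∈? q))
... | yes witness = witness
... | no ∄ = contradiction (λ {x} x∈p → decidable-stable (x ∈? q) (λ x∉q → ∄ (x , x∈p , x∉q))) p⊈q

∣p∣<∣q∣⇒∃∈∉ : ∀ {n} {p q : Subset n} → ∣ p ∣ < ∣ q ∣ → ∃ λ x → x ∈ q × x ∉ p
∣p∣<∣q∣⇒∃∈∉ ∣p∣<∣q∣ = ⊈⇒∃∈∉ (λ q⊆p → <⇒≱ ∣p∣<∣q∣ (p⊆q⇒∣p∣≤∣q∣ q⊆p))

0<∣p∣⇒nonempty : ∀ {n} {p : Subset n} → 0 < ∣ p ∣ → Nonempty p
0<∣p∣⇒nonempty {n} {p} 0<∣p∣ with ∣p∣<∣q∣⇒∃∈∉ {p = ⊥} (subst (_< ∣ p ∣) (sym (∣⊥∣≡0 n)) 0<∣p∣)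
... | x , x∈p , _ = x , x∈p

module _ {A : Set} (search : ∀ {P : Pred A 0ℓ} → Decidable P → Dec (∃ P)) where

  argmax : ∀ {P : Pred A 0ℓ} → Decidable P → (μ : A → ℕ) (B : ℕ) → (∀ x → μ x ≤ B) →
           ∃ P → ∃ λ b → P b × (∀ {x} → P x → μ x ≤ μ b)
  argmax {P} P? μ B μ≤B (a , Pa) = climb B a Pa (m≤n+m B (μ a))
    where
    climb : ∀ fuel a → P a → B ≤ μ a + fuel → ∃ λ b → P b × (∀ {x} → P x → μ x ≤ μ b)
    climb zero a Pa B≤μa = a , Pa , λ {x} _ → ≤-trans (μ≤B x) (subst (B ≤_) (+-identityʳ (μ a)) B≤μa)
    climb (suc fuel) a Pa B≤ with search (λ x → P? x ×-dec (μ a <? μ x))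
    ... | no ∄ = a , Pa , λ Px → ≮⇒≥ (λ μa<μx → ∄ (_ , Px , μa<μx))
    ... | yes (x , Px , μa<μx) =
      climb fuel x Px (≤-trans B≤ (subst (_≤ μ x + fuel) (sym (+-suc (μ a) fuel)) (+-monoˡ-≤ fuel μa<μx)))

triangle : ℕ → ℕ
triangle zero = 0
triangle (suc m) = triangle m + suc m

tetrahedral : ℕ → ℕ
tetrahedral zero = 0
tetrahedral (suc m) = tetrahedral m + triangle (suc m)

module _ where
  open +-*-Solver
  open ≡-Reasoning

  2*triangle : ∀ m → 2 * triangle m ≡ m * suc m
  2*triangle zero = refl
  2*triangle (suc m) = begin
    2 * (triangle m + suc m)    ≡⟨ *-distribˡ-+ 2 (triangle m) (suc m) ⟩
    2 * triangle m + 2 * suc m  ≡⟨ cong (_+ 2 * suc m) (2*triangle m) ⟩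
    m * suc m + 2 * suc m       ≡⟨ solve 1 (λ m → m :* (con 1 :+ m) :+ con 2 :* (con 1 :+ m)
                                                 := (con 1 :+ m) :* (con 2 :+ m)) refl m ⟩
    suc m * suc (suc m)         ∎

  tetrahedral*6 : ∀ m → tetrahedral m * 6 ≡ m * suc m * suc (suc m)
  tetrahedral*6 zero = refl
  tetrahedral*6 (suc m) = begin
    (tetrahedral m + triangle (suc m)) * 6
      ≡⟨ solve 2 (λ t s → (t :+ s) :* con 6 := t :* con 6 :+ con 3 :* (con 2 :* s))
               refl (tetrahedral m) (triangle (suc m)) ⟩
    tetrahedral m * 6 + 3 * (2 * triangle (suc m))
      ≡⟨ cong₂ (λ t s → t + 3 * s) (tetrahedral*6 m) (2*triangle (suc m)) ⟩
    m * suc m * suc (suc m) + 3 * (suc m * suc (suc m))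
      ≡⟨ solve 1 (λ m → m :* (con 1 :+ m) :* (con 2 :+ m) :+ con 3 :* ((con 1 :+ m) :* (con 2 :+ m))
                      := (con 1 :+ m) :* (con 2 :+ m) :* (con 3 :+ m)) refl m ⟩
    suc m * suc (suc m) * suc (suc (suc m)) ∎

tetrahedral≡ : ∀ m → tetrahedral m ≡ (m * suc m * suc (suc m)) / 6
tetrahedral≡ m = trans (sym (m*n/n≡m (tetrahedral m) 6)) (cong (_/ 6) (tetrahedral*6 m))

TwinFree : ∀ {m} → Graph m → Set
TwinFree H = ∀ i j → (∀ k → adj H i k ≡ adj H j k) → i ≡ j

induced-copy : ∀ {m n} {H : Graph m} (G : Graph n) (f : Fin m → Fin n) → TwinFree H →
               (∀ i j → adj G (f i) (f j) ≡ adj H i j) → InducedCopy H G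
induced-copy G f twinFree preserves = f , injective , preserves
  where
  injective : ∀ {i j} → f i ≡ f j → i ≡ j
  injective {i} {j} fi≡fj = twinFree i j λ k →
    trans (sym (preserves i k)) (trans (cong (λ z → adj G z (f k)) fi≡fj) (preserves j k))

P4∪P2-twinFree : TwinFree P4∪P2
P4∪P2-twinFree = toWitness {a? = all? λ i → all? λ j →
  all? (λ k → adj P4∪P2 i k ≟ᵇ adj P4∪P2 j k) →-dec (i ≟ᶠ j)} _

module _ {n : ℕ} (G : Graph n) where

  private
    variable
      A B I K Q R S T : Subset n
      k m : ℕ
      v x : Fin n

  adj-flip : ∀ {x y b} → adj G x y ≡ b → adj G y x ≡ b
  adj-flip {x} {y} e = trans (adj-sym G y x) e

  N : Fin n → Subset n
  N v = tabulate (adj G v)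

  ∈N⇒adj : ∀ {v x} → x ∈ N v → adj G v x ≡ true
  ∈N⇒adj {v} {x} x∈N = trans (sym (lookup∘tabulate (adj G v) x)) ([]=⇒lookup x∈N)

  adj⇒∈N : ∀ {v x} → adj G v x ≡ true → x ∈ N v
  adj⇒∈N {v} {x} vx = lookup⇒[]= x (N v) (trans (lookup∘tabulate (adj G v) x) vx)

  ∉N⇒nonadj : ∀ {v x} → x ∉ N v → adj G v x ≡ false
  ∉N⇒nonadj {v} {x} x∉N with adj G v x in vx
  ... | true = contradiction (adj⇒∈N vx) x∉N
  ... | false = refl

  ∈∁N⇒nonadj : ∀ {v x} → x ∈ ∁ (N v) → adj G v x ≡ false
  ∈∁N⇒nonadj = ∉N⇒nonadj ∘ x∈∁p⇒x∉p

  Complete : Subset n → Subset n → Set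
  Complete A B = ∀ {x y} → x ∈ A → y ∈ B → adj G x y ≡ true

  IsIndependent : Subset n → Set
  IsIndependent I = ∀ x y → x ∈ I → y ∈ I → adj G x y ≡ false

  Dominates : Subset n → Subset n → Set
  Dominates I T = ∀ {x} → x ∈ T → x ∉ I → Nonempty (I ∩ N x)

  CliqueNumberAtMost : Subset n → ℕ → Set
  CliqueNumberAtMost S k = ∀ Q → Q ⊆ S → IsClique G Q → ∣ Q ∣ ≤ k

  clique? : Decidable (IsClique G)
  clique? Q = all? λ x → all? λ y →
    x ∈? Q →-dec (y ∈? Q →-dec (¬? (x ≟ᶠ y) →-dec (adj G x y ≟ᵇ true)))

  independent? : Decidable IsIndependent
  independent? I = all? λ x → all? λ y → x ∈? I →-dec (y ∈? I →-dec (adj G x y ≟ᵇ false))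

  ⁅⁆-clique : ∀ v → IsClique G ⁅ v ⁆
  ⁅⁆-clique v x y x∈ y∈ x≢y = contradiction (trans (x∈⁅y⁆⇒x≡y v x∈) (sym (x∈⁅y⁆⇒x≡y v y∈))) x≢y

  ⊆-clique : Q ⊆ K → IsClique G K → IsClique G Q
  ⊆-clique Q⊆K K-clique x y x∈Q y∈Q = K-clique x y (Q⊆K x∈Q) (Q⊆K y∈Q)

  complete⇒disjoint : Complete A B → x ∈ A → x ∉ B
  complete⇒disjoint {x = x} A-B x∈A x∈B = contradiction (trans (sym (A-B x∈A x∈B)) (adj-irrefl G x)) λ ()

  ∪-clique : IsClique G A → IsClique G B → Complete A B → IsClique G (A ∪ B)
  ∪-clique {A = A} {B = B} A-clique B-clique A-B x y x∈ y∈ x≢y with x∈p∪q⁻ A B x∈ | x∈p∪q⁻ A B y∈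
  ... | inj₁ x∈A | inj₁ y∈A = A-clique x y x∈A y∈A x≢y
  ... | inj₁ x∈A | inj₂ y∈B = A-B x∈A y∈B
  ... | inj₂ x∈B | inj₁ y∈A = adj-flip (A-B y∈A x∈B)
  ... | inj₂ x∈B | inj₂ y∈B = B-clique x y x∈B y∈B x≢y

  ∪-⊆ : A ⊆ S → B ⊆ S → A ∪ B ⊆ S
  ∪-⊆ {A = A} {B = B} A⊆S B⊆S x∈ with x∈p∪q⁻ A B x∈
  ... | inj₁ x∈A = A⊆S x∈A
  ... | inj₂ x∈B = B⊆S x∈B

  ⁅⁆-⊆ : v ∈ S → ⁅ v ⁆ ⊆ S
  ⁅⁆-⊆ {v = v} v∈S x∈ = subst (_∈ _) (sym (x∈⁅y⁆⇒x≡y v x∈)) v∈S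

  ∣∪⁅⁆∣ : v ∉ A → ∣ A ∪ ⁅ v ⁆ ∣ ≡ ∣ A ∣ + 1
  ∣∪⁅⁆∣ {v = v} {A = A} v∉A = trans (∣p∪q∣≡∣p∣+∣q∣ A ⁅ v ⁆ v∉⁅v⁆) (cong (∣ A ∣ +_) (∣⁅x⁆∣≡1 v))
    where
    v∉⁅v⁆ : ∀ {x} → x ∈ A → x ∉ ⁅ v ⁆
    v∉⁅v⁆ x∈A x∈⁅v⁆ = v∉A (subst (_∈ A) (x∈⁅y⁆⇒x≡y v x∈⁅v⁆) x∈A)

  cliqueNumberAtMost-complete : CliqueNumberAtMost S k → R ⊆ S → IsClique G R →
    T ⊆ S → Complete T R → ∣ R ∣ + m ≡ k → CliqueNumberAtMost T m
  cliqueNumberAtMost-complete {k = k} {R = R} {m = m} ω R⊆S R-clique T⊆S T-R ∣R∣+m≡k Q Q⊆T Q-clique =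
    +-cancelˡ-≤ ∣ R ∣ ∣ Q ∣ m (begin
      ∣ R ∣ + ∣ Q ∣  ≡⟨ +-comm ∣ R ∣ ∣ Q ∣ ⟩
      ∣ Q ∣ + ∣ R ∣  ≡⟨ ∣p∪q∣≡∣p∣+∣q∣ Q R (complete⇒disjoint Q-R) ⟨
      ∣ Q ∪ R ∣      ≤⟨ ω (Q ∪ R) (∪-⊆ (T⊆S ∘ Q⊆T) R⊆S) (∪-clique Q-clique R-clique Q-R) ⟩
      k              ≡⟨ ∣R∣+m≡k ⟨
      ∣ R ∣ + m      ∎)
    where
    open ≤-Reasoning
    Q-R : Complete Q R
    Q-R x∈Q y∈R = T-R (Q⊆T x∈Q) y∈R

  cliqueNumberAtMost-0 : CliqueNumberAtMost S 0 → x ∉ S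
  cliqueNumberAtMost-0 {x = x} ω x∈S =
    contradiction (subst (_≤ 0) (∣⁅x⁆∣≡1 x) (ω ⁅ x ⁆ (⁅⁆-⊆ x∈S) (⁅⁆-clique x))) λ ()

  maximum-clique-⊈N : CliqueNumberAtMost S ∣ R ∣ → R ⊆ S → IsClique G R → x ∈ S → R ⊈ N x
  maximum-clique-⊈N {R = R} {x = x} ω R⊆S R-clique x∈S R⊆Nx =
    cliqueNumberAtMost-0 (cliqueNumberAtMost-complete ω R⊆S R-clique (⁅⁆-⊆ x∈S) x-R (+-identityʳ ∣ R ∣))
      (x∈⁅x⁆ x)
    where
    x-R : Complete ⁅ x ⁆ R
    x-R x′∈ y∈R rewrite x∈⁅y⁆⇒x≡y x x′∈ = ∈N⇒adj (R⊆Nx y∈R)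

  cliqueNumberAtMost-1⇒independent : CliqueNumberAtMost S 1 → IsIndependent S
  cliqueNumberAtMost-1⇒independent ω x y x∈S y∈S with adj G x y in xy
  ... | false = refl
  ... | true = ⊥-elim (maximum-clique-⊈N (subst (CliqueNumberAtMost _) (sym (∣⁅x⁆∣≡1 y)) ω)
                         (⁅⁆-⊆ y∈S) (⁅⁆-clique y) x∈S (⁅⁆-⊆ (adj⇒∈N xy)))

  record Colouring (S : Subset n) (k : ℕ) : Set where
    field
      colour : Fin n → ℕ
      colour<k : ∀ {x} → x ∈ S → colour x < k
      proper : ∀ {x y} → x ∈ S → y ∈ S → adj G x y ≡ true → colour x ≢ colour y

  colouring-mono : ∀ {a b} → a ≤ b → Colouring S a → Colouring S b
  colouring-mono a≤b C = record { Colouring C; colour<k = λ x∈S → ≤-trans (Colouring.colour<k C x∈S) a≤b }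

  colouring-empty : (∀ {x} → x ∉ S) → Colouring S 0
  colouring-empty empty = record
    { colour = λ _ → 0
    ; colour<k = λ x∈S → contradiction x∈S empty
    ; proper = λ x∈S → contradiction x∈S empty
    }

  ⊆-independent : A ⊆ B → IsIndependent B → IsIndependent A
  ⊆-independent A⊆B B-indep x y x∈A y∈A = B-indep x y (A⊆B x∈A) (A⊆B y∈A)

  independent⇒colouring : IsIndependent S → Colouring S 1
  independent⇒colouring {S = S} indep = record
    { colour = λ _ → 0 ; colour<k = λ _ → z<s ; proper = proper }
    where
    proper : ∀ {x y} → x ∈ S → y ∈ S → adj G x y ≡ true → 0 ≢ 0
    proper {x} {y} x∈S y∈S xy _ = contradiction (trans (sym xy) (indep x y x∈S y∈S)) λ ()

  colouring-split : ∀ {S a b} (p : Subset n) →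
    Colouring (S ∩ p) a → Colouring (S ∩ ∁ p) b → Colouring S (a + b)
  colouring-split {S} {a} {b} p C₁ C₂ = record { colour = colour ; colour<k = colour<k ; proper = proper }
    where
    module C₁ = Colouring C₁
    module C₂ = Colouring C₂
    ∈∩ : ∀ {x} → x ∈ S → x ∈ p → x ∈ S ∩ p
    ∈∩ x∈S x∈p = x∈p∩q⁺ (x∈S , x∈p)
    ∈∩∁ : ∀ {x} → x ∈ S → x ∉ p → x ∈ S ∩ ∁ p
    ∈∩∁ x∈S x∉p = x∈p∩q⁺ (x∈S , x∉p⇒x∈∁p x∉p)
    colour : Fin n → ℕ
    colour x with x ∈? p
    ... | yes _ = C₁.colour x
    ... | no _ = a + C₂.colour x
    colour<k : ∀ {x} → x ∈ S → colour x < a + b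
    colour<k {x} x∈S with x ∈? p
    ... | yes x∈p = ≤-trans (C₁.colour<k (∈∩ x∈S x∈p)) (m≤m+n a b)
    ... | no x∉p = +-monoʳ-< a (C₂.colour<k (∈∩∁ x∈S x∉p))
    proper : ∀ {x y} → x ∈ S → y ∈ S → adj G x y ≡ true → colour x ≢ colour y
    proper {x} {y} x∈S y∈S xy with x ∈? p | y ∈? p
    ... | yes x∈p | yes y∈p = C₁.proper (∈∩ x∈S x∈p) (∈∩ y∈S y∈p) xy
    ... | yes x∈p | no _ = <⇒≢ (≤-trans (C₁.colour<k (∈∩ x∈S x∈p)) (m≤m+n a _))
    ... | no _ | yes y∈p = ≢-sym (<⇒≢ (≤-trans (C₁.colour<k (∈∩ y∈S y∈p)) (m≤m+n a _)))
    ... | no x∉p | no y∉p = C₂.proper (∈∩∁ x∈S x∉p) (∈∩∁ y∈S y∉p) xy ∘ +-cancelˡ-≡ a _ _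

  colouring⇒chromaticAtMost : Colouring ⊤ k → ChromaticAtMost G k
  colouring⇒chromaticAtMost C = (λ x → fromℕ< (colour<k ∈⊤)) , λ u v uv cu≡cv →
    proper ∈⊤ ∈⊤ uv (trans (sym (toℕ-fromℕ< _)) (trans (cong toℕ cu≡cv) (toℕ-fromℕ< _)))
    where open Colouring C

  -- χ = ω on P₄-free vertex subsets

  record InducedP₄ (a b c d : Fin n) : Set where
    field
      ab : adj G a b ≡ true
      bc : adj G b c ≡ true
      cd : adj G c d ≡ true
      ac : adj G a c ≡ false
      bd : adj G b d ≡ false
      ad : adj G a d ≡ false

  P₄Free : Subset n → Set
  P₄Free T = ∀ {a b c d} → a ∈ T → b ∈ T → c ∈ T → d ∈ T → ¬ InducedP₄ a b c d

  P₄Free-⊆ : ∀ {T′ T} → T′ ⊆ T → P₄Free T → P₄Free T′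
  P₄Free-⊆ T′⊆T P₄-free a∈ b∈ c∈ d∈ = P₄-free (T′⊆T a∈) (T′⊆T b∈) (T′⊆T c∈) (T′⊆T d∈)

  maximal-independent : ∀ T → ∃ λ I → I ⊆ T × IsIndependent I × Dominates I T
  maximal-independent T with argmax anySubset? (λ I → I ⊆? T ×-dec independent? I) ∣_∣ n ∣p∣≤n
                                    (⊥ , ⊥⊆ , λ x y x∈⊥ → contradiction x∈⊥ ∉⊥)
  ... | I , (I⊆T , I-indep) , maximum = I , I⊆T , I-indep , dominates
    where
    dominates : Dominates I T
    dominates {x} x∈T x∉I with nonempty? (I ∩ N x)
    ... | yes neighbour = neighbour
    ... | no none = contradiction (maximum (∪-⊆ I⊆T (⁅⁆-⊆ x∈T) , I+x-indep))
                      (<⇒≱ (subst (∣ I ∣ <_) (sym (∣∪⁅⁆∣ x∉I)) (m<m+n ∣ I ∣ z<s)))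
      where
      x≁I : ∀ {y} → y ∈ I → adj G x y ≡ false
      x≁I y∈I = ∉N⇒nonadj λ y∈N → none (_ , x∈p∩q⁺ (y∈I , y∈N))
      I+x-indep : IsIndependent (I ∪ ⁅ x ⁆)
      I+x-indep y z y∈ z∈ with x∈p∪q⁻ I ⁅ x ⁆ y∈ | x∈p∪q⁻ I ⁅ x ⁆ z∈
      ... | inj₁ y∈I | inj₁ z∈I = I-indep y z y∈I z∈I
      ... | inj₁ y∈I | inj₂ z∈x rewrite x∈⁅y⁆⇒x≡y x z∈x = adj-flip (x≁I y∈I)
      ... | inj₂ y∈x | inj₁ z∈I rewrite x∈⁅y⁆⇒x≡y x y∈x = x≁I z∈I
      ... | inj₂ y∈x | inj₂ z∈x rewrite x∈⁅y⁆⇒x≡y x y∈x | x∈⁅y⁆⇒x≡y x z∈x = adj-irrefl G x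

  -- Pick b ∈ I seeing the most of Q and q₂ ∈ Q it misses; a neighbour a ∈ I of q₂ must
  -- miss some q ∈ Q seen by b, and then b q q₂ a is an induced P₄.
  maximal-independent-meets-maximum-clique : P₄Free T →
    I ⊆ T → IsIndependent I → Dominates I T →
    Q ⊆ T → IsClique G Q → CliqueNumberAtMost T ∣ Q ∣ → Nonempty Q → ¬ (Q ⊆ ∁ I)
  maximal-independent-meets-maximum-clique {T = T} {I = I} {Q = Q}
    P₄-free I⊆T I-indep dom Q⊆T Q-clique ω (x₀ , x₀∈Q) Q⊆∁I
    with dom (Q⊆T x₀∈Q) (x∈∁p⇒x∉p (Q⊆∁I x₀∈Q))
  ... | y₀ , y₀∈I∩N
    with argmax any? (_∈? I) (λ y → ∣ Q ∩ N y ∣) n (λ y → ∣p∣≤n (Q ∩ N y)) (y₀ , p∩q⊆p I _ y₀∈I∩N)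
  ... | b , b∈I , b-best with ⊈⇒∃∈∉ (maximum-clique-⊈N ω Q⊆T Q-clique (I⊆T b∈I))
  ... | q₂ , q₂∈Q , q₂∉Nb with x∈p∩q⁻ I _ (proj₂ (dom (Q⊆T q₂∈Q) (x∈∁p⇒x∉p (Q⊆∁I q₂∈Q))))
  ... | a∈I , a∈Nq₂ with ⊈⇒∃∈∉ {p = Q ∩ N b} {Q ∩ N _} (λ Nb⊆Na →
        <⇒≱ (p⊂q⇒∣p∣<∣q∣ (Nb⊆Na , q₂ , x∈p∩q⁺ (q₂∈Q , adj⇒∈N (adj-flip (∈N⇒adj a∈Nq₂))) ,
                          q₂∉Nb ∘ p∩q⊆q Q _))
            (b-best a∈I))
  ... | q , q∈Q∩Nb , q∉Q∩Na with x∈p∩q⁻ Q _ q∈Q∩Nb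
  ... | q∈Q , q∈Nb =
    P₄-free (I⊆T b∈I) (Q⊆T q∈Q) (Q⊆T q₂∈Q) (I⊆T a∈I) record
      { ab = ∈N⇒adj q∈Nb
      ; bc = Q-clique _ _ q∈Q q₂∈Q λ q≡q₂ → q₂∉Nb (subst (_∈ N b) q≡q₂ q∈Nb)
      ; cd = ∈N⇒adj a∈Nq₂
      ; ac = ∉N⇒nonadj q₂∉Nb
      ; bd = adj-flip (∉N⇒nonadj λ q∈Na → q∉Q∩Na (x∈p∩q⁺ (q∈Q , q∈Na)))
      ; ad = I-indep _ _ b∈I a∈I
      }

  P₄-free⇒colouring : ∀ k → P₄Free T → CliqueNumberAtMost T k → Colouring T k
  P₄-free⇒colouring zero _ ω = colouring-empty (cliqueNumberAtMost-0 ω)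
  P₄-free⇒colouring {T = T} (suc k) P₄-free ω with maximal-independent T
  ... | I , I⊆T , I-indep , dom =
    colouring-split I (independent⇒colouring (⊆-independent (p∩q⊆q T I) I-indep))
                      (P₄-free⇒colouring k (P₄Free-⊆ (p∩q⊆p T _) P₄-free) ω′)
    where
    ω′ : CliqueNumberAtMost (T ∩ ∁ I) k
    ω′ Q Q⊆ Q-clique = ≤-pred (≤∧≢⇒< (ω Q (p∩q⊆p T _ ∘ Q⊆) Q-clique) λ ∣Q∣≡ →
      maximal-independent-meets-maximum-clique P₄-free I⊆T I-indep dom (p∩q⊆p T _ ∘ Q⊆) Q-clique
        (subst (CliqueNumberAtMost T) (sym ∣Q∣≡) ω)
        (0<∣p∣⇒nonempty (subst (0 <_) (sym ∣Q∣≡) z<s))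
        (p∩q⊆q T _ ∘ Q⊆))

  -- Colouring (P₄ ∪ P₂)-free graphs

  P₄-free-beside-edge : HFree P4∪P2 G → ∀ {u v} → adj G u v ≡ true →
    T ⊆ ∁ (N u) → T ⊆ ∁ (N v) → P₄Free T
  P₄-free-beside-edge {T = T} free {u} {v} uv T⊆∁Nu T⊆∁Nv {a} {b} {c} {d} a∈T b∈T c∈T d∈T P₄ =
    free (induced-copy {H = P4∪P2} G vertex P4∪P2-twinFree preserves)
    where
    open InducedP₄ P₄
    ≁u : ∀ {x} → x ∈ T → adj G x u ≡ false
    ≁u = adj-flip ∘ ∈∁N⇒nonadj ∘ T⊆∁Nu
    ≁v : ∀ {x} → x ∈ T → adj G x v ≡ false
    ≁v = adj-flip ∘ ∈∁N⇒nonadj ∘ T⊆∁Nv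
    vertex : Fin 6 → Fin n
    vertex 0F = a
    vertex 1F = b
    vertex 2F = c
    vertex 3F = d
    vertex 4F = u
    vertex 5F = v
    preserves : ∀ i j → adj G (vertex i) (vertex j) ≡ adj P4∪P2 i j
    preserves 0F 0F = adj-irrefl G a
    preserves 0F 1F = ab
    preserves 0F 2F = ac
    preserves 0F 3F = ad
    preserves 0F 4F = ≁u a∈T
    preserves 0F 5F = ≁v a∈T
    preserves 1F 1F = adj-irrefl G b
    preserves 1F 2F = bc
    preserves 1F 3F = bd
    preserves 1F 4F = ≁u b∈T
    preserves 1F 5F = ≁v b∈T
    preserves 2F 2F = adj-irrefl G c
    preserves 2F 3F = cd
    preserves 2F 4F = ≁u c∈T
    preserves 2F 5F = ≁v c∈T
    preserves 3F 3F = adj-irrefl G d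
    preserves 3F 4F = ≁u d∈T
    preserves 3F 5F = ≁v d∈T
    preserves 4F 4F = adj-irrefl G u
    preserves 4F 5F = uv
    preserves 5F 5F = adj-irrefl G v
    preserves 1F 0F = adj-flip (preserves 0F 1F)
    preserves 2F 0F = adj-flip (preserves 0F 2F)
    preserves 2F 1F = adj-flip (preserves 1F 2F)
    preserves 3F 0F = adj-flip (preserves 0F 3F)
    preserves 3F 1F = adj-flip (preserves 1F 3F)
    preserves 3F 2F = adj-flip (preserves 2F 3F)
    preserves 4F 0F = adj-flip (preserves 0F 4F)
    preserves 4F 1F = adj-flip (preserves 1F 4F)
    preserves 4F 2F = adj-flip (preserves 2F 4F)
    preserves 4F 3F = adj-flip (preserves 3F 4F)
    preserves 5F 0F = adj-flip (preserves 0F 5F)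
    preserves 5F 1F = adj-flip (preserves 1F 5F)
    preserves 5F 2F = adj-flip (preserves 2F 5F)
    preserves 5F 3F = adj-flip (preserves 3F 5F)
    preserves 5F 4F = adj-flip (preserves 4F 5F)

  module _ (free : HFree P4∪P2 G) where

    -- R holds the vertices u₁, …, u_l of K ∖ {v} already used to split T.
    module _ (ω : CliqueNumberAtMost S k) (K⊆S : K ⊆ S) (K-clique : IsClique G K) (∣K∣≡k : ∣ K ∣ ≡ k)
             (v∈K : v ∈ K) where

      non-neighbours-colouring : ∀ l → R ⊆ K → v ∉ R → ∣ R ∣ + suc l ≡ k →
        T ⊆ S ∩ ∁ (N v) → Complete T R → Colouring T (triangle (suc l))
      non-neighbours-colouring zero R⊆K v∉R size T⊆ T-R =
        independent⇒colouring (cliqueNumberAtMost-1⇒independent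
          (cliqueNumberAtMost-complete ω (K⊆S ∘ R⊆K) (⊆-clique R⊆K K-clique) (p∩q⊆p S _ ∘ T⊆) T-R size))
      non-neighbours-colouring {R = R} {T = T} (suc l) R⊆K v∉R size T⊆ T-R
        with ∣p∣<∣q∣⇒∃∈∉ {p = R ∪ ⁅ v ⁆}
               (subst₂ _<_ (sym (∣∪⁅⁆∣ v∉R)) (trans size (sym ∣K∣≡k)) (+-monoʳ-< ∣ R ∣ (s<s z<s)))
      ... | u , u∈K , u∉R+v =
        colouring-split (N u)
          (non-neighbours-colouring l (∪-⊆ R⊆K (⁅⁆-⊆ u∈K)) v∉R+u size′ (T⊆ ∘ p∩q⊆p T _) T∩Nu-R+u)
          (P₄-free⇒colouring (suc (suc l))
            (P₄-free-beside-edge free uv (p∩q⊆q T _) (p∩q⊆q S _ ∘ T⊆ ∘ p∩q⊆p T _))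
            (cliqueNumberAtMost-complete ω (K⊆S ∘ R⊆K) (⊆-clique R⊆K K-clique)
              (p∩q⊆p S _ ∘ T⊆ ∘ p∩q⊆p T _) (T-R ∘ p∩q⊆p T _) size))
        where
        u∉R : u ∉ R
        u∉R = u∉R+v ∘ x∈p∪q⁺ ∘ inj₁
        u≢v : u ≢ v
        u≢v u≡v = u∉R+v (x∈p∪q⁺ (inj₂ (subst (_∈ ⁅ v ⁆) (sym u≡v) (x∈⁅x⁆ v))))
        uv : adj G u v ≡ true
        uv = K-clique u v u∈K v∈K u≢v
        v∉R+u : v ∉ R ∪ ⁅ u ⁆
        v∉R+u v∈ with x∈p∪q⁻ R ⁅ u ⁆ v∈
        ... | inj₁ v∈R = v∉R v∈R
        ... | inj₂ v∈u = u≢v (sym (x∈⁅y⁆⇒x≡y u v∈u))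
        size′ : ∣ R ∪ ⁅ u ⁆ ∣ + suc l ≡ k
        size′ = trans (cong (_+ suc l) (∣∪⁅⁆∣ u∉R)) (trans (+-assoc ∣ R ∣ 1 (suc l)) size)
        T∩Nu-R+u : Complete (T ∩ N u) (R ∪ ⁅ u ⁆)
        T∩Nu-R+u x∈ y∈ with x∈p∪q⁻ R ⁅ u ⁆ y∈
        ... | inj₁ y∈R = T-R (p∩q⊆p T _ x∈) y∈R
        ... | inj₂ y∈u rewrite x∈⁅y⁆⇒x≡y u y∈u = adj-flip (∈N⇒adj (p∩q⊆q T _ x∈))

    cliqueNumberAtMost⇒colouring : ∀ k → CliqueNumberAtMost S k → Colouring S (tetrahedral k)
    cliqueNumberAtMost⇒colouring zero ω = colouring-empty (cliqueNumberAtMost-0 ω)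
    cliqueNumberAtMost⇒colouring {S = S} (suc k) ω
      with anySubset? (λ K → K ⊆? S ×-dec clique? K ×-dec ∣ K ∣ ≟ suc k)
    ... | no ∄K = colouring-mono (m≤m+n _ _) (cliqueNumberAtMost⇒colouring k ω′)
      where
      ω′ : CliqueNumberAtMost S k
      ω′ Q Q⊆S Q-clique = ≤-pred (≤∧≢⇒< (ω Q Q⊆S Q-clique) λ ∣Q∣≡ → ∄K (Q , Q⊆S , Q-clique , ∣Q∣≡))
    ... | yes (K , K⊆S , K-clique , ∣K∣≡)
      with 0<∣p∣⇒nonempty (subst (0 <_) (sym ∣K∣≡) z<s)
    ... | v , v∈K =
      colouring-split (N v)
        (cliqueNumberAtMost⇒colouring k
          (cliqueNumberAtMost-complete ω (⁅⁆-⊆ (K⊆S v∈K)) (⁅⁆-clique v) (p∩q⊆p S _) S∩Nv-v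
            (cong (_+ k) (∣⁅x⁆∣≡1 v))))
        (non-neighbours-colouring ω K⊆S K-clique ∣K∣≡ v∈K k ⊥⊆ ∉⊥
          (cong (_+ suc k) (∣⊥∣≡0 n)) ⊆-refl (λ _ y∈⊥ → contradiction y∈⊥ ∉⊥))
      where
      S∩Nv-v : Complete (S ∩ N v) ⁅ v ⁆
      S∩Nv-v x∈ y∈ rewrite x∈⁅y⁆⇒x≡y v y∈ = adj-flip (∈N⇒adj (p∩q⊆q S _ x∈))

theorem2 : ∀ {n} (G : Graph n) (w : ℕ) → HFree P4∪P2 G → CliqueNumber G w →
    ChromaticAtMost G ((w * suc w * suc (suc w)) / 6)
theorem2 G w free (_ , ω≤w) =
  subst (ChromaticAtMost G) (tetrahedral≡ w)
    (colouring⇒chromaticAtMost G (cliqueNumberAtMost⇒colouring G free w λ Q _ → ω≤w Q))
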